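{- (i) If every intrinsically generically computable set is intrinsically coarsely computable, then the intrinsically densely computable sets are exactly the intrinsically coarsely computable sets. (ii) If some intrinsically generically computable set is not intrinsically coarsely computable, then the class of intrinsically densely computable sets strictly contains both the class of intrinsically generically computable sets and the class of intrinsically coarsely computable sets.
   Context: For $S\subseteq\omega$ and $n\geq 1$, $\rho_n(S)=|S\cap\{0,\dots,n-1\}|/n$, $\overline{\rho}(S)=\limsup_n\rho_n(S)$. A set $S$ is intrinsically small if $\overline{\rho}(\pi(S))=0$ for every computable permutation $\pi$ of $\omega$. $A\subseteq\omega$ is intrinsically coarsely computable if there is a total computable $\varphi$ with $\{n:\varphi(n)\neq A(n)\}$ intrinsically small; intrinsically generically computable if there is a partial computable $\varphi$ with $\varphi(n)\downarrow\Rightarrow\varphi(n)=A(n)$ and $\{n:\varphi(n)\uparrow\}$ intrinsically small; intrinsically densely computable if there is a partial computable $\varphi$ such that $\{n: \text{not }(\varphi(n)\downarrow=A(n))\}$ is intrinsically small. -}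

module Defs where

open import Data.Nat using (ℕ; zero; suc; _*_; _≤_; _<_)
open import Data.Bool using (Bool; true; false)
open import Data.Fin using (Fin)
open import Data.Vec using (Vec; []; _∷_; lookup)
open import Data.List using (List; length)
open import Data.List.Relation.Unary.All using (All)
open import Data.List.Relation.Unary.Unique.Propositional using (Unique)
open import Data.Product using (Σ; ∃; _×_; _,_)
open import Function using (Bijective)
open import Relation.Binary.PropositionalEquality using (_≡_)
open import Relation.Nullary using (¬_)

data PR : ℕ → Set where
  zer  : PR 0
  succ : PR 1
  proj : ∀ {k} → Fin k → PR k
  comp : ∀ {k m} → PR m → Vec (PR k) m → PR k
  prec : ∀ {k} → PR k → PR (suc (suc k)) → PR (suc k)
  mu   : ∀ {k} → PR (suc k) → PR k

mutual
  data Eval : ∀ {k} → PR k → Vec ℕ k → ℕ → Set where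
    ev-zer  : Eval zer [] 0
    ev-succ : ∀ {x} → Eval succ (x ∷ []) (suc x)
    ev-proj : ∀ {k} {i : Fin k} {xs} → Eval (proj i) xs (lookup xs i)
    ev-comp : ∀ {k m} {f : PR m} {gs : Vec (PR k) m} {xs ys v} →
              EvalVec xs gs ys → Eval f ys v → Eval (comp f gs) xs v
    ev-prec0 : ∀ {k} {f : PR k} {g} {xs v} →
               Eval f xs v → Eval (prec f g) (0 ∷ xs) v
    ev-precS : ∀ {k} {f : PR k} {g} {n xs r v} →
               Eval (prec f g) (n ∷ xs) r → Eval g (n ∷ r ∷ xs) v →
               Eval (prec f g) (suc n ∷ xs) v
    ev-mu : ∀ {k} {f : PR (suc k)} {xs y} →
            MuSearch f xs 0 y → Eval (mu f) xs y

  data EvalVec {k : ℕ} (xs : Vec ℕ k) : ∀ {m} → Vec (PR k) m → Vec ℕ m → Set where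
    [] : EvalVec xs [] []
    _∷_ : ∀ {m} {g : PR k} {gs : Vec (PR k) m} {y ys} →
          Eval g xs y → EvalVec xs gs ys → EvalVec xs (g ∷ gs) (y ∷ ys)

  data MuSearch {k : ℕ} (f : PR (suc k)) (xs : Vec ℕ k) : ℕ → ℕ → Set where
    found : ∀ {i} → Eval f (i ∷ xs) 0 → MuSearch f xs i i
    step  : ∀ {i v y} → Eval f (i ∷ xs) (suc v) → MuSearch f xs (suc i) y →
            MuSearch f xs i y

_⟦_⟧≡_ : PR 1 → ℕ → ℕ → Set
e ⟦ n ⟧≡ v = Eval e (n ∷ []) v

_⟦_⟧↓ : PR 1 → ℕ → Set
e ⟦ n ⟧↓ = ∃ λ v → e ⟦ n ⟧≡ v

Total : PR 1 → Set
Total e = ∀ n → e ⟦ n ⟧↓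

Computable : (ℕ → ℕ) → Set
Computable f = Σ (PR 1) λ e → ∀ n → e ⟦ n ⟧≡ f n

ComputablePermutation : (ℕ → ℕ) → Set
ComputablePermutation π = Computable π × Bijective _≡_ _≡_ π

-- subsets of ω (for the sets A) as characteristic functions; 0/1 values
⌊_⌋ : Bool → ℕ
⌊ false ⌋ = 0
⌊ true ⌋ = 1

-- ρ_n(S) ≤ 1/(k+1): every finite set of distinct elements of S ∩ {0,…,n-1}
-- has at most n/(k+1) elements, i.e. (k+1)·|S ∩ n| ≤ n.
DensityAtMost1/suc : (ℕ → Set) → ℕ → ℕ → Set
DensityAtMost1/suc S k n =
  (xs : List ℕ) → Unique xs → All (λ x → x < n × S x) xs → suc k * length xs ≤ n

UpperDensityZero : (ℕ → Set) → Set
UpperDensityZero S = ∀ k → ∃ λ N → ∀ n → N ≤ n → DensityAtMost1/suc S k n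

Image : (ℕ → ℕ) → (ℕ → Set) → (ℕ → Set)
Image π S m = ∃ λ n → S n × π n ≡ m

IntrinsicallySmall : (ℕ → Set) → Set
IntrinsicallySmall S =
  (π : ℕ → ℕ) → ComputablePermutation π → UpperDensityZero (Image π S)

IntrinsicallyCoarselyComputable : (ℕ → Bool) → Set
IntrinsicallyCoarselyComputable A =
  Σ (PR 1) λ e → Total e × IntrinsicallySmall (λ n → ¬ (e ⟦ n ⟧≡ ⌊ A n ⌋))

IntrinsicallyGenericallyComputable : (ℕ → Bool) → Set
IntrinsicallyGenericallyComputable A =
  Σ (PR 1) λ e → (∀ n v → e ⟦ n ⟧≡ v → v ≡ ⌊ A n ⌋)
               × IntrinsicallySmall (λ n → ¬ (e ⟦ n ⟧↓))

IntrinsicallyDenselyComputable : (ℕ → Bool) → Set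
IntrinsicallyDenselyComputable A =
  Σ (PR 1) λ e → IntrinsicallySmall (λ n → ¬ (e ⟦ n ⟧≡ ⌊ A n ⌋))

-- (i) If φ densely computes A, let ψ = sg ∘ φ and C = {n : ψ(n) = 1}. Then ψ generically
-- computes C, and C agrees with A wherever φ does. An algorithm coarsely computing C
-- therefore errs on A only inside the union of two intrinsically small sets.
-- (ii) Coarse and generic computability both imply dense computability, so it remains to
-- find a coarsely computable set B which is not generically computable. For each j choose
-- x_j above x_{j-1} where φ_j converges and where every injective total φ_i, i ≤ j, takes a
-- value ≥ (j+1)²; such a point exists whenever φ_j has an intrinsically small divergence
-- set. Put B(x_j) = 1 iff φ_j(x_j) = 0, and B = 0 elsewhere. Then B defeats every generic
-- algorithm, while a computable permutation φ_i sends at most i + O(√n) of the x_j below n,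
-- so {x_j} is intrinsically small and the zero function coarsely computes B.
module Submission where

open import Defs
open import Axiom.ExcludedMiddle using (ExcludedMiddle)
open import Data.Bool using (Bool; true; false)
open import Data.Empty using (⊥; ⊥-elim)
open import Data.Fin using (Fin; toℕ; fromℕ<)
open import Data.Fin.Properties using (toℕ<n; fromℕ<-toℕ)
open import Data.List using (List; []; _∷_; length; filter; map; downFrom)
open import Data.List.Properties using (length-map; length-downFrom)
import Data.List.Relation.Unary.All as All
open import Data.List.Relation.Unary.All using (All; []; _∷_)
import Data.List.Relation.Unary.All.Properties as All
open import Data.List.Relation.Unary.AllPairs using (_∷_)
open import Data.List.Relation.Unary.Unique.Propositional using (Unique)
import Data.List.Relation.Unary.Unique.Propositional.Properties as Unique
open import Data.Maybe using (Maybe; just; nothing; maybe′)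
open import Data.Maybe.Properties using (just-injective)
open import Data.Nat
open import Data.Nat.DivMod using (_/_; _%_; m≡m%n+[m/n]*n; m%n<n; m/n*n≤m; m*n/n≡m; /-mono-≤)
open import Data.Nat.Properties
open import Data.Nat.Tactic.RingSolver using (solve-∀)
open import Data.Product using (Σ; ∃; ∃₂; _×_; _,_; proj₁; proj₂)
open import Data.Sum using (_⊎_; inj₁; inj₂)
open import Data.Vec using (Vec; []; _∷_)
open import Function using (_∘_)
open import Function.Bundles using (_⇔_; mk⇔)
open import Function.Definitions using (Injective)
open import Level using (0ℓ)
open import Relation.Binary using (tri<; tri≈; tri>)
open import Relation.Binary.PropositionalEquality
open import Relation.Nullary using (¬_; Dec; yes; no; does)
open import Relation.Nullary.Decidable using (dec⇒maybe)
open import Relation.Unary using (Pred; Decidable; ∁; _∪_; _∩_; _⊆_; _⊆′_)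
open import Relation.Unary.Properties using (∁?)

mutual
  Eval-det : ∀ {k} {f : PR k} {xs v w} → Eval f xs v → Eval f xs w → v ≡ w
  Eval-det ev-zer ev-zer = refl
  Eval-det ev-succ ev-succ = refl
  Eval-det ev-proj ev-proj = refl
  Eval-det (ev-comp gs f) (ev-comp gs′ f′) with EvalVec-det gs gs′
  ... | refl = Eval-det f f′
  Eval-det (ev-prec0 f) (ev-prec0 f′) = Eval-det f f′
  Eval-det (ev-precS r g) (ev-precS r′ g′) with Eval-det r r′
  ... | refl = Eval-det g g′
  Eval-det (ev-mu s) (ev-mu s′) = MuSearch-det s s′

  EvalVec-det : ∀ {k m} {xs : Vec ℕ k} {gs : Vec (PR k) m} {ys zs} →
                EvalVec xs gs ys → EvalVec xs gs zs → ys ≡ zs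
  EvalVec-det [] [] = refl
  EvalVec-det (g ∷ gs) (g′ ∷ gs′) = cong₂ _∷_ (Eval-det g g′) (EvalVec-det gs gs′)

  MuSearch-det : ∀ {k} {f : PR (suc k)} {xs i y z} →
                 MuSearch f xs i y → MuSearch f xs i z → y ≡ z
  MuSearch-det (found _) (found _) = refl
  MuSearch-det (found z) (step s _) with Eval-det z s
  ... | ()
  MuSearch-det (step s _) (found z) with Eval-det s z
  ... | ()
  MuSearch-det (step _ r) (step _ r′) = MuSearch-det r r′

const0 : ∀ k → PR k
const0 k = comp zer []

const0-eval : ∀ {k} (xs : Vec ℕ k) → Eval (const0 k) xs 0
const0-eval xs = ev-comp [] ev-zer

sg : PR 1
sg = prec zer (comp succ (const0 2 ∷ []))

sg-eval : ∀ v → sg ⟦ v ⟧≡ ⌊ 0 <ᵇ v ⌋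
sg-eval zero = ev-prec0 ev-zer
sg-eval (suc v) = ev-precS (sg-eval v) (ev-comp (const0-eval _ ∷ []) ev-succ)

-- A surjective numbering of PR 1

-- Enumerates ℕ × ℕ along the antidiagonals a + b = s.
next : ℕ × ℕ → ℕ × ℕ
next (zero , b) = suc b , 0
next (suc a , b) = a , suc b

unpair : ℕ → ℕ × ℕ
unpair zero = 0 , 0
unpair (suc n) = next (unpair n)

unpair-surjective : ∀ a b → ∃ λ n → unpair n ≡ (a , b)
unpair-surjective a b = onDiagonal (a + b) a b refl
  where
  onDiagonal : ∀ s a b → a + b ≡ s → ∃ λ n → unpair n ≡ (a , b)
  onDiagonal zero zero zero _ = 0 , refl
  onDiagonal s a (suc b) a+b≡s with onDiagonal s (suc a) b (trans (sym (+-suc a b)) a+b≡s)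
  ... | n , e = suc n , cong next e
  onDiagonal (suc s) (suc a) zero a+0≡s with onDiagonal s 0 a (trans (sym (+-identityʳ a)) (suc-injective a+0≡s))
  ... | n , e = suc n , cong next e

projOr0 : ℕ → (k : ℕ) → PR k
projOr0 r k with r <? k
... | yes r<k = proj (fromℕ< r<k)
... | no _ = const0 k

projOr0-toℕ : ∀ {k} (i : Fin k) → projOr0 (toℕ i) k ≡ proj i
projOr0-toℕ {k} i with toℕ i <? k
... | yes i<k = cong proj (fromℕ<-toℕ i i<k)
... | no i≮k = ⊥-elim (i≮k (toℕ<n i))

-- The first argument is fuel, on which the recursion runs; a code is read as a tag and a
-- payload, the payload being unpaired again into the codes of the subterms.
mutual
  decode : ℕ → ℕ → (k : ℕ) → PR k
  decode zero n k = const0 k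
  decode (suc f) n k = decodeTagged f (proj₁ (unpair n)) (proj₂ (unpair n)) k

  decodeTagged : ℕ → ℕ → ℕ → (k : ℕ) → PR k
  decodeTagged f 0 r 0 = zer
  decodeTagged f 1 r 1 = succ
  decodeTagged f 2 r k = projOr0 r k
  decodeTagged f 3 r k = comp (decode f (proj₁ (unpair (proj₂ (unpair r)))) (proj₁ (unpair r)))
                              (decodeVec f (proj₂ (unpair (proj₂ (unpair r)))) k (proj₁ (unpair r)))
  decodeTagged f 4 r (suc k) = prec (decode f (proj₁ (unpair r)) k)
                                    (decode f (proj₂ (unpair r)) (suc (suc k)))
  decodeTagged f 5 r k = mu (decode f r (suc k))
  decodeTagged f _ r k = const0 k

  decodeVec : ℕ → ℕ → (k m : ℕ) → Vec (PR k) m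
  decodeVec f n k zero = []
  decodeVec f n k (suc m) = decode f (proj₁ (unpair n)) k ∷ decodeVec f (proj₂ (unpair n)) k m

decode-suc : ∀ f n {k t r} → unpair n ≡ (t , r) → decode (suc f) n k ≡ decodeTagged f t r k
decode-suc f n e rewrite e = refl

HasCode : ∀ {k} → PR k → Set
HasCode {k} c = ∃₂ λ n N → ∀ f → N ≤ f → decode f n k ≡ c

HasCodeVec : ∀ {k m} → Vec (PR k) m → Set
HasCodeVec {k} {m} gs = ∃₂ λ n N → ∀ f → N ≤ f → decodeVec f n k m ≡ gs

mutual
  hasCode : ∀ {k} (c : PR k) → HasCode c
  hasCode zer with unpair-surjective 0 0
  ... | n , e = n , 1 , λ { (suc f) _ → decode-suc f n e }
  hasCode succ with unpair-surjective 1 0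
  ... | n , e = n , 1 , λ { (suc f) _ → decode-suc f n e }
  hasCode (proj i) with unpair-surjective 2 (toℕ i)
  ... | n , e = n , 1 , λ { (suc f) _ → trans (decode-suc f n e) (projOr0-toℕ i) }
  hasCode {k} (comp {m = m} g gs) with hasCode g | hasCodeVec gs
  ... | a , Na , ha | b , Nb , hb with unpair-surjective a b
  ... | r′ , ab with unpair-surjective m r′
  ... | r , mr′ with unpair-surjective 3 r
  ... | n , e = n , suc (Na ⊔ Nb) , λ { (suc f) (s≤s N≤f) →
        trans (decode-suc f n e) (trans (payload f mr′ ab)
          (cong₂ comp (ha f (m⊔n≤o⇒m≤o Na Nb N≤f)) (hb f (m⊔n≤o⇒n≤o Na Nb N≤f)))) }
    where
    payload : ∀ f → unpair r ≡ (m , r′) → unpair r′ ≡ (a , b) →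
              decodeTagged f 3 r k ≡ comp (decode f a m) (decodeVec f b k m)
    payload f e₁ e₂ rewrite e₁ | e₂ = refl
  hasCode {suc k} (prec g h) with hasCode g | hasCode h
  ... | a , Na , ha | b , Nb , hb with unpair-surjective a b
  ... | r , ab with unpair-surjective 4 r
  ... | n , e = n , suc (Na ⊔ Nb) , λ { (suc f) (s≤s N≤f) →
        trans (decode-suc f n e) (trans (payload f ab)
          (cong₂ prec (ha f (m⊔n≤o⇒m≤o Na Nb N≤f)) (hb f (m⊔n≤o⇒n≤o Na Nb N≤f)))) }
    where
    payload : ∀ f → unpair r ≡ (a , b) →
              decodeTagged f 4 r (suc k) ≡ prec (decode f a k) (decode f b (suc (suc k)))
    payload f e₁ rewrite e₁ = refl
  hasCode (mu g) with hasCode g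
  ... | a , Na , ha with unpair-surjective 5 a
  ... | n , e = n , suc Na , λ { (suc f) (s≤s N≤f) → trans (decode-suc f n e) (cong mu (ha f N≤f)) }

  hasCodeVec : ∀ {k m} (gs : Vec (PR k) m) → HasCodeVec gs
  hasCodeVec [] = 0 , 0 , λ _ _ → refl
  hasCodeVec {k} {suc m} (g ∷ gs) with hasCode g | hasCodeVec gs
  ... | a , Na , ha | b , Nb , hb with unpair-surjective a b
  ... | n , e = n , Na ⊔ Nb , λ f N≤f →
        trans (cons f e) (cong₂ _∷_ (ha f (m⊔n≤o⇒m≤o Na Nb N≤f)) (hb f (m⊔n≤o⇒n≤o Na Nb N≤f)))
    where
    cons : ∀ f → unpair n ≡ (a , b) → decodeVec f n k (suc m) ≡ decode f a k ∷ decodeVec f b k m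
    cons f e₁ rewrite e₁ = refl

-- Index t = ⟨fuel, code⟩.
code : ℕ → PR 1
code t = decode (proj₁ (unpair t)) (proj₂ (unpair t)) 1

code-surjective : ∀ e → ∃ λ t → code t ≡ e
code-surjective e with hasCode e
... | n , N , h with unpair-surjective N n
... | t , e′ = t , fueled e′
  where
  fueled : unpair t ≡ (N , n) → code t ≡ e
  fueled e₁ rewrite e₁ = h N ≤-refl

≤-halves : ∀ c a b n → c * 2 * a ≤ n → c * 2 * b ≤ n → c * (a + b) ≤ n
≤-halves c a b n ca≤n cb≤n = *-cancelʳ-≤ (c * (a + b)) n 2 (begin
  c * (a + b) * 2       ≡⟨ distrib c a b ⟩
  c * 2 * a + c * 2 * b ≤⟨ +-mono-≤ ca≤n cb≤n ⟩
  n + n                 ≡⟨ double n ⟩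
  n * 2                 ∎)
  where
  open ≤-Reasoning
  distrib : ∀ c a b → c * (a + b) * 2 ≡ c * 2 * a + c * 2 * b
  distrib = solve-∀
  double : ∀ n → n + n ≡ n * 2
  double = solve-∀

density-mono : ∀ {S T : Pred ℕ 0ℓ} {k n} → S ⊆ T →
               DensityAtMost1/suc T k n → DensityAtMost1/suc S k n
density-mono S⊆T T-sparse xs u ps = T-sparse xs u (All.map (λ (x<n , s) → x<n , S⊆T s) ps)

image-mono : ∀ {S T : Pred ℕ 0ℓ} (π : ℕ → ℕ) → S ⊆ T → Image π S ⊆ Image π T
image-mono π S⊆T (n , s , πn≡m) = n , S⊆T s , πn≡m

image-∪ : ∀ {S T : Pred ℕ 0ℓ} (π : ℕ → ℕ) → Image π (S ∪ T) ⊆ Image π S ∪ Image π T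
image-∪ π (n , inj₁ s , πn≡m) = inj₁ (n , s , πn≡m)
image-∪ π (n , inj₂ t , πn≡m) = inj₂ (n , t , πn≡m)

small-mono : ∀ {S T : Pred ℕ 0ℓ} → S ⊆ T → IntrinsicallySmall T → IntrinsicallySmall S
small-mono S⊆T T-small π π-perm k with T-small π π-perm k
... | N , sparse = N , λ n N≤n → density-mono {k = k} {n} (image-mono π S⊆T) (sparse n N≤n)

id-permutation : ComputablePermutation (λ n → n)
id-permutation = (proj Data.Fin.zero , λ n → ev-proj) , (λ e → e) , (λ y → y , λ e → e)

small⇒upperDensityZero : ∀ {S : Pred ℕ 0ℓ} → IntrinsicallySmall S → UpperDensityZero S
small⇒upperDensityZero S-small k with S-small (λ n → n) id-permutation k
... | N , sparse = N , λ n N≤n → density-mono {k = k} {n} (λ {m} s → m , s , refl) (sparse n N≤n)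

AtMost : ℕ → Pred ℕ 0ℓ → Set
AtMost c P = ∀ xs → Unique xs → All P xs → length xs ≤ c

⋃< : ℕ → (ℕ → Pred ℕ 0ℓ) → Pred ℕ 0ℓ
⋃< R U x = ∃ λ j → j < R × U j x

atMost-mono : ∀ {P Q : Pred ℕ 0ℓ} {a b} → Q ⊆ P → a ≤ b → AtMost a P → AtMost b Q
atMost-mono Q⊆P a≤b P-few xs u qs = ≤-trans (P-few xs u (All.map Q⊆P qs)) a≤b

subsingleton⇒atMost1 : ∀ {P : Pred ℕ 0ℓ} → (∀ {x y} → P x → P y → x ≡ y) → AtMost 1 P
subsingleton⇒atMost1 P-prop [] _ _ = z≤n
subsingleton⇒atMost1 P-prop (x ∷ []) _ _ = s≤s z≤n
subsingleton⇒atMost1 P-prop (x ∷ y ∷ _) ((x∉ ∷ _) ∷ _) (px ∷ py ∷ _) = ⊥-elim (x∉ (P-prop px py))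

length-filter-∁ : ∀ {P : Pred ℕ 0ℓ} (P? : Decidable P) xs →
                  length xs ≡ length (filter P? xs) + length (filter (∁? P?) xs)
length-filter-∁ P? [] = refl
length-filter-∁ P? (x ∷ xs) with does (P? x)
... | true = cong suc (length-filter-∁ P? xs)
... | false = trans (cong suc (length-filter-∁ P? xs)) (sym (+-suc _ _))

half-plus-bound : ∀ n y K → n ≤ y + K → 2 * y ≤ n → n ≤ K + K
half-plus-bound n y K n≤y+K 2y≤n = +-cancelˡ-≤ n n (K + K) (begin
  n + n             ≤⟨ +-mono-≤ n≤y+K n≤y+K ⟩
  (y + K) + (y + K) ≡⟨ rearrange y K ⟩
  2 * y + (K + K)   ≤⟨ +-monoˡ-≤ (K + K) 2y≤n ⟩
  n + (K + K)       ∎)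
  where
  open ≤-Reasoning
  rearrange : ∀ y K → (y + K) + (y + K) ≡ 2 * y + (K + K)
  rearrange = solve-∀

square<⇒< : ∀ {j r d} → suc j * suc j < suc r * d → d ≤ suc r → j < r
square<⇒< {j} {r} sq<[1+r]d d≤1+r = ≰⇒> λ r≤j →
  <⇒≱ sq<[1+r]d (≤-trans (*-monoʳ-≤ (suc r) d≤1+r) (*-mono-≤ (s≤s r≤j) (s≤s r≤j)))

coarse⊆′dense : IntrinsicallyCoarselyComputable ⊆′ IntrinsicallyDenselyComputable
coarse⊆′dense A (e , _ , errors-small) = e , errors-small

generic⊆′dense : IntrinsicallyGenericallyComputable ⊆′ IntrinsicallyDenselyComputable
generic⊆′dense A (e , correct , undefined-small) = e , small-mono wrong⇒undefined undefined-small
  where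
  wrong⇒undefined : ∀ {n} → ¬ e ⟦ n ⟧≡ ⌊ A n ⌋ → ¬ e ⟦ n ⟧↓
  wrong⇒undefined wrong (v , ev) = wrong (subst (e ⟦ _ ⟧≡_) (correct _ v ev) ev)

sg∘ : PR 1 → PR 1
sg∘ φ = comp sg (φ ∷ [])

sg∘-output : ∀ {φ n w} → sg∘ φ ⟦ n ⟧≡ w → ∃ λ b → w ≡ ⌊ b ⌋
sg∘-output (ev-comp (_∷_ {y = v} _ []) sg-ev) = (0 <ᵇ v) , Eval-det sg-ev (sg-eval v)

sg∘-eval : ∀ {φ n} b → φ ⟦ n ⟧≡ ⌊ b ⌋ → sg∘ φ ⟦ n ⟧≡ ⌊ b ⌋
sg∘-eval false ev = ev-comp (ev ∷ []) (sg-eval 0)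
sg∘-eval true ev = ev-comp (ev ∷ []) (sg-eval 1)

totalize : ∀ {e} → Dec (Total e) → ℕ → ℕ
totalize (yes total) n = proj₁ (total n)
totalize (no _) n = n

totalize-computes : ∀ {e} {f : ℕ → ℕ} (d : Dec (Total e)) → (∀ n → e ⟦ n ⟧≡ f n) →
                    ∀ n → totalize d n ≡ f n
totalize-computes (yes total) computes n = Eval-det (proj₂ (total n)) (computes n)
totalize-computes (no partial) computes n = ⊥-elim (partial λ n → _ , computes n)

dec⇒maybe-just : ∀ {A : Set} (d : Dec A) → A → ∃ λ a → dec⇒maybe d ≡ just a
dec⇒maybe-just (yes a) _ = a , refl
dec⇒maybe-just (no ¬a) a = ⊥-elim (¬a a)

module Classical (lem : ExcludedMiddle 0ℓ) where

  record Partition (P Q : Pred ℕ 0ℓ) (xs : List ℕ) : Set where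
    field
      left right : List ℕ
      unique-left : Unique left
      unique-right : Unique right
      all-left : All P left
      all-right : All Q right
      length-split : length xs ≡ length left + length right

  partition : ∀ {P Q R : Pred ℕ 0ℓ} → R ⊆ P ∪ Q → ∀ xs → Unique xs → All R xs → Partition P Q xs
  partition {P} {Q} {R} R⊆P∪Q xs u rs = record
    { left = filter P? xs
    ; right = filter (∁? P?) xs
    ; unique-left = Unique.filter⁺ P? u
    ; unique-right = Unique.filter⁺ (∁? P?) u
    ; all-left = All.all-filter P? xs
    ; all-right = All.zipWith outside-P (All.all-filter (∁? P?) xs , All.filter⁺ (∁? P?) rs)
    ; length-split = length-filter-∁ P? xs
    }
    where
    P? : Decidable P
    P? _ = lem
    outside-P : ∁ P ∩ R ⊆ Q
    outside-P (¬p , r) with R⊆P∪Q r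
    ... | inj₁ p = ⊥-elim (¬p p)
    ... | inj₂ q = q

  atMost-∪ : ∀ {P Q : Pred ℕ 0ℓ} {a b} → AtMost a P → AtMost b Q → AtMost (a + b) (P ∪ Q)
  atMost-∪ P-few Q-few xs u ps =
    let open Partition (partition (λ p → p) xs u ps) in
    subst (_≤ _) (sym length-split)
      (+-mono-≤ (P-few left unique-left all-left) (Q-few right unique-right all-right))

  atMost-⋃< : ∀ {c} R {U : ℕ → Pred ℕ 0ℓ} → (∀ j → AtMost c (U j)) → AtMost (R * c) (⋃< R U)
  atMost-⋃< zero U-few [] _ _ = z≤n
  atMost-⋃< zero U-few (_ ∷ _) _ ((_ , () , _) ∷ _)
  atMost-⋃< (suc R) {U} U-few = atMost-mono last-or-earlier ≤-refl (atMost-∪ (U-few R) (atMost-⋃< R U-few))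
    where
    last-or-earlier : ⋃< (suc R) U ⊆ U R ∪ ⋃< R U
    last-or-earlier (j , s≤s j≤R , u) with m≤n⇒m<n∨m≡n j≤R
    ... | inj₁ j<R = inj₂ (j , j<R , u)
    ... | inj₂ refl = inj₁ u

  atMost-< : ∀ b → AtMost b (_< b)
  atMost-< b = atMost-mono (λ {x} x<b → x , x<b , refl) (≤-reflexive (*-identityʳ b))
    (atMost-⋃< b {λ j x → x ≡ j} λ j → subsingleton⇒atMost1 λ { refl refl → refl })

  atMost-preimage : ∀ {f : ℕ → ℕ} → Injective _≡_ _≡_ f → ∀ M → AtMost M (λ x → f x < M)
  atMost-preimage {f} f-inj M xs u fxs<M =
    subst (_≤ M) (length-map f xs) (atMost-< M (map f xs) (Unique.map⁺ f-inj u) (All.map⁺ fxs<M))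

  atMost-injective-preimage : ∀ (f : ℕ → ℕ) M → AtMost M (λ x → Injective _≡_ _≡_ f × f x < M)
  atMost-injective-preimage f M [] _ _ = z≤n
  atMost-injective-preimage f M xs@(_ ∷ _) u ps@((f-inj , _) ∷ _) =
    atMost-preimage f-inj M xs u (All.map proj₂ ps)

  density-∪ : ∀ {S T : Pred ℕ 0ℓ} {k n} → DensityAtMost1/suc S (suc (k * 2)) n →
              DensityAtMost1/suc T (suc (k * 2)) n → DensityAtMost1/suc (S ∪ T) k n
  density-∪ {S} {T} {k} {n} S-sparse T-sparse xs u ps =
    let open Partition (partition split xs u ps) in
    subst (λ l → suc k * l ≤ n) (sym length-split)
      (≤-halves (suc k) (length left) (length right) n
        (S-sparse left unique-left all-left) (T-sparse right unique-right all-right))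
    where
    split : (λ x → x < n × (S ∪ T) x) ⊆ (λ x → x < n × S x) ∪ (λ x → x < n × T x)
    split (x<n , inj₁ s) = inj₁ (x<n , s)
    split (x<n , inj₂ t) = inj₂ (x<n , t)

  small-∪ : ∀ {S T : Pred ℕ 0ℓ} → IntrinsicallySmall S → IntrinsicallySmall T →
            IntrinsicallySmall (S ∪ T)
  small-∪ S-small T-small π π-perm k
    with S-small π π-perm (suc (k * 2)) | T-small π π-perm (suc (k * 2))
  ... | N₁ , S-sparse | N₂ , T-sparse = N₁ + N₂ , λ n N≤n →
    density-mono {k = k} {n} (image-∪ π)
      (density-∪ {k = k} (S-sparse n (m+n≤o⇒m≤o N₁ N≤n)) (T-sparse n (m+n≤o⇒n≤o N₁ N≤n)))

  sparse-complement-escapes : ∀ {P F : Pred ℕ 0ℓ} {K} → UpperDensityZero (∁ P) → AtMost K F →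
                              ∃ λ x → P x × ¬ F x
  sparse-complement-escapes {P} {F} {K} ∁P-sparse F-few with lem {∃ λ x → P x × ¬ F x}
  ... | yes escaping = escaping
  ... | no none with ∁P-sparse 1
  ... | N , sparse = ⊥-elim (<⇒≱ (m≤n+m (suc (K + K)) N)
          (half-plus-bound n (length left) K n≤left+K (sparse n (m≤m+n N _) left unique-left all-left)))
    where
    n = N + suc (K + K)
    classify : (_< n) ⊆ (λ x → x < n × ∁ P x) ∪ F
    classify {x} x<n with lem {P x}
    ... | no ¬p = inj₁ (x<n , ¬p)
    ... | yes p with lem {F x}
    ... | yes f = inj₂ f
    ... | no ¬f = ⊥-elim (none (x , p , ¬f))
    open Partition (partition classify (downFrom n) (Unique.downFrom⁺ n)
                                       (All.applyDownFrom⁺₁ (λ x → x) n (λ x<n → x<n)))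
    n≤left+K : n ≤ length left + K
    n≤left+K = begin
      n                          ≡⟨ length-downFrom n ⟨
      length (downFrom n)        ≡⟨ length-split ⟩
      length left + length right ≤⟨ +-monoʳ-≤ (length left) (F-few right unique-right all-right) ⟩
      length left + K            ∎
      where open ≤-Reasoning

  outputsOne : PR 1 → ℕ → Bool
  outputsOne ψ n = does (lem {ψ ⟦ n ⟧≡ 1})

  outputsOne-correct : ∀ {ψ n} b → ψ ⟦ n ⟧≡ ⌊ b ⌋ → ⌊ b ⌋ ≡ ⌊ outputsOne ψ n ⌋
  outputsOne-correct {ψ} {n} b ev = agrees b ev lem
    where
    agrees : ∀ b → ψ ⟦ n ⟧≡ ⌊ b ⌋ → (d : Dec (ψ ⟦ n ⟧≡ 1)) → ⌊ b ⌋ ≡ ⌊ does d ⌋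
    agrees false ev (yes ev₁) = Eval-det ev ev₁
    agrees false ev (no _) = refl
    agrees true ev (yes _) = refl
    agrees true ev (no ¬ev₁) = ⊥-elim (¬ev₁ ev)

  dense⊆′coarse : IntrinsicallyGenericallyComputable ⊆′ IntrinsicallyCoarselyComputable →
                  IntrinsicallyDenselyComputable ⊆′ IntrinsicallyCoarselyComputable
  dense⊆′coarse generic⊆′coarse A (φ , φ-errors-small) = coarse-for-A (generic⊆′coarse C C-generic)
    where
    C : ℕ → Bool
    C = outputsOne (sg∘ φ)

    C-generic : IntrinsicallyGenericallyComputable C
    C-generic = sg∘ φ , correct , small-mono undefined⇒φ-wrong φ-errors-small
      where
      correct : ∀ n w → sg∘ φ ⟦ n ⟧≡ w → w ≡ ⌊ C n ⌋
      correct n w ev with sg∘-output ev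
      ... | b , refl = outputsOne-correct b ev
      undefined⇒φ-wrong : ∀ {n} → ¬ sg∘ φ ⟦ n ⟧↓ → ¬ φ ⟦ n ⟧≡ ⌊ A n ⌋
      undefined⇒φ-wrong {n} undefined ev = undefined (_ , sg∘-eval (A n) ev)

    C-agrees : ∀ {n} → φ ⟦ n ⟧≡ ⌊ A n ⌋ → ⌊ A n ⌋ ≡ ⌊ C n ⌋
    C-agrees {n} ev = outputsOne-correct (A n) (sg∘-eval (A n) ev)

    coarse-for-A : IntrinsicallyCoarselyComputable C → IntrinsicallyCoarselyComputable A
    coarse-for-A (τ , τ-total , τ-errors-small) =
      τ , τ-total , small-mono wrong-on-C-or-φ-wrong (small-∪ τ-errors-small φ-errors-small)
      where
      wrong-on-C-or-φ-wrong : ∀ {n} → ¬ τ ⟦ n ⟧≡ ⌊ A n ⌋ → ¬ τ ⟦ n ⟧≡ ⌊ C n ⌋ ⊎ ¬ φ ⟦ n ⟧≡ ⌊ A n ⌋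
      wrong-on-C-or-φ-wrong {n} τ-wrong with lem {φ ⟦ n ⟧≡ ⌊ A n ⌋}
      ... | yes φ-right = inj₁ (τ-wrong ∘ subst (τ ⟦ n ⟧≡_) (sym (C-agrees φ-right)))
      ... | no φ-wrong = inj₂ φ-wrong

  -- A coarsely computable set which is not generically computable

  -- φ_i if φ_i is total, the identity otherwise; every computable function is some totalized i.
  totalized : ℕ → ℕ → ℕ
  totalized i = totalize (lem {Total (code i)})

  Low : ℕ → Pred ℕ 0ℓ
  Low j = ⋃< (suc j) (λ i x → Injective _≡_ _≡_ (totalized i) × totalized i x < suc j * suc j)

  low-few : ∀ j → AtMost (suc j * (suc j * suc j)) (Low j)
  low-few j = atMost-⋃< (suc j) (λ i → atMost-injective-preimage (totalized i) (suc j * suc j))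

  Candidate : ℕ → ℕ → Pred ℕ 0ℓ
  Candidate j b x = b ≤ x × code j ⟦ x ⟧↓ × ¬ Low j x

  candidate-exists : ∀ j b → IntrinsicallySmall (λ n → ¬ code j ⟦ n ⟧↓) → ∃ (Candidate j b)
  candidate-exists j b undefined-small
    with sparse-complement-escapes (small⇒upperDensityZero undefined-small)
                                   (atMost-∪ (atMost-< b) (low-few j))
  ... | x , defined , ¬exceptional = x , ≮⇒≥ (¬exceptional ∘ inj₁) , defined , ¬exceptional ∘ inj₂

  floor : ℕ → ℕ
  floor zero = 0
  floor (suc j) = maybe′ (suc ∘ proj₁) (floor j) (dec⇒maybe (lem {∃ (Candidate j (floor j))}))

  witness : ∀ j → Maybe (∃ (Candidate j (floor j)))
  witness j = dec⇒maybe lem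

  -- Point j x says x = x_j; there is no x_j when no candidate lies above floor j.
  Point : ℕ → Pred ℕ 0ℓ
  Point j x = Σ (Candidate j (floor j) x) λ c → witness j ≡ just (x , c)

  point-unique : ∀ {j x y} → Point j x → Point j y → x ≡ y
  point-unique (_ , wx) (_ , wy) = cong proj₁ (just-injective (trans (sym wx) wy))

  point-exists : ∀ j → IntrinsicallySmall (λ n → ¬ code j ⟦ n ⟧↓) → ∃ (Point j)
  point-exists j undefined-small with dec⇒maybe-just lem (candidate-exists j (floor j) undefined-small)
  ... | (x , c) , w = x , c , w

  floor-after-point : ∀ {j x} → Point j x → floor (suc j) ≡ suc x
  floor-after-point {j} (_ , w) = cong (maybe′ (suc ∘ proj₁) (floor j)) w

  floor-step : ∀ j → floor j ≤ floor (suc j)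
  floor-step j = above (witness j)
    where
    above : (w : Maybe (∃ (Candidate j (floor j)))) → floor j ≤ maybe′ (suc ∘ proj₁) (floor j) w
    above (just (x , floor≤x , _)) = m≤n⇒m≤1+n floor≤x
    above nothing = ≤-refl

  floor-mono : ∀ {j j′} → j ≤′ j′ → floor j ≤ floor j′
  floor-mono ≤′-refl = ≤-refl
  floor-mono (≤′-step j≤′j′) = ≤-trans (floor-mono j≤′j′) (floor-step _)

  points-increasing : ∀ {j j′ x y} → j < j′ → Point j x → Point j′ y → x < y
  points-increasing {j} {j′} {x} {y} j<j′ px ((floor≤y , _) , _) = begin-strict
    x             <⟨ n<1+n x ⟩
    suc x         ≡⟨ floor-after-point px ⟨
    floor (suc j) ≤⟨ floor-mono (≤⇒≤′ j<j′) ⟩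
    floor j′      ≤⟨ floor≤y ⟩
    y             ∎
    where open ≤-Reasoning

  point-injective : ∀ {j j′ x} → Point j x → Point j′ x → j ≡ j′
  point-injective {j} {j′} px px′ with <-cmp j j′
  ... | tri< j<j′ _ _ = ⊥-elim (<-irrefl refl (points-increasing j<j′ px px′))
  ... | tri≈ _ j≡j′ _ = j≡j′
  ... | tri> _ _ j′<j = ⊥-elim (<-irrefl refl (points-increasing j′<j px′ px))

  point-large : ∀ {i j x} → Injective _≡_ _≡_ (totalized i) → i ≤ j → Point j x →
                suc j * suc j ≤ totalized i x
  point-large i-inj i≤j ((_ , _ , ¬low) , _) = ≮⇒≥ λ low → ¬low (_ , s≤s i≤j , i-inj , low)

  Points : Pred ℕ 0ℓ
  Points x = ∃ λ j → Point j x

  points-small : IntrinsicallySmall Points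
  points-small π ((e , computes) , π-inj , _) k with code-surjective e
  ... | i , refl = d * d + d * i , sparse
    where
    d = suc k * 2

    totalized≗π : ∀ n → totalized i n ≡ π n
    totalized≗π = totalize-computes lem computes

    totalized-inj : Injective _≡_ _≡_ (totalized i)
    totalized-inj {x} {y} eq = π-inj (trans (sym (totalized≗π x)) (trans eq (totalized≗π y)))

    sparse : ∀ n → d * d + d * i ≤ n → DensityAtMost1/suc (Image π Points) k n
    sparse n N≤n xs u ps = ≤-trans (*-monoʳ-≤ (suc k) few) (≤-halves (suc k) i r n di≤n dr≤n)
      where
      r = n / d
      di≤n : d * i ≤ n
      di≤n = m+n≤o⇒n≤o (d * d) N≤n
      dr≤n : d * r ≤ n
      dr≤n = subst (_≤ n) (*-comm r d) (m/n*n≤m n d)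
      d≤r : d ≤ r
      d≤r = subst (_≤ r) (m*n/n≡m d d) (/-mono-≤ {o = d} {p = d} (m+n≤o⇒m≤o (d * d) N≤n) ≤-refl)
      n<[1+r]d : n < suc r * d
      n<[1+r]d = begin-strict
        n             ≡⟨ m≡m%n+[m/n]*n n d ⟩
        n % d + r * d <⟨ +-monoˡ-< (r * d) (m%n<n n d) ⟩
        suc r * d     ∎
        where open ≤-Reasoning
      index<i+r : ∀ {j x} → Point j x → π x < n → j < i + r
      index<i+r {j} {x} px πx<n with j <? i
      ... | yes j<i = m≤n⇒m≤n+o r j<i
      ... | no j≮i = m≤n⇒m≤o+n i (square<⇒< (≤-trans (s≤s sq≤πx) (≤-trans πx<n (<⇒≤ n<[1+r]d)))
                                             (m≤n⇒m≤1+n d≤r))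
        where
        sq≤πx : suc j * suc j ≤ π x
        sq≤πx = subst (_ ≤_) (totalized≗π x) (point-large totalized-inj (≮⇒≥ j≮i) px)
      below : (λ m → m < n × Image π Points m) ⊆ ⋃< (i + r) (λ j → Image π (Point j))
      below (m<n , x , (j , px) , refl) = j , index<i+r px m<n , x , px , refl
      few : length xs ≤ i + r
      few = atMost-mono below (≤-reflexive (*-identityʳ (i + r)))
              (atMost-⋃< (i + r) λ j → subsingleton⇒atMost1
                λ { (x , px , refl) (y , py , refl) → cong π (point-unique px py) }) xs u ps

  Zeroed : Pred ℕ 0ℓ
  Zeroed x = ∃ λ j → Point j x × code j ⟦ x ⟧≡ 0

  B : ℕ → Bool
  B x = does (lem {Zeroed x})

  B-coarse : IntrinsicallyCoarselyComputable B
  B-coarse = const0 1 , (λ n → 0 , const0-eval _) , small-mono (λ {n} → errors n lem) points-small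
    where
    errors : ∀ n (d : Dec (Zeroed n)) → ¬ const0 1 ⟦ n ⟧≡ ⌊ does d ⌋ → Points n
    errors n (yes (j , px , _)) _ = j , px
    errors n (no _) wrong = ⊥-elim (wrong (const0-eval _))

  B-diagonal : ∀ {j x v} → Point j x → code j ⟦ x ⟧≡ v → v ≢ ⌊ B x ⌋
  B-diagonal {j} {x} {v} px ev = differs lem
    where
    differs : (d : Dec (Zeroed x)) → v ≢ ⌊ does d ⌋
    differs (yes (j′ , px′ , ev₀)) v≡1 with point-injective px px′
    ... | refl = 0≢1+n (trans (sym (Eval-det ev ev₀)) v≡1)
    differs (no ¬zeroed) v≡0 = ¬zeroed (j , px , subst (code j ⟦ x ⟧≡_) v≡0 ev)

  B-not-generic : ¬ IntrinsicallyGenericallyComputable B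
  B-not-generic (ψ , correct , undefined-small) with code-surjective ψ
  ... | j , refl with point-exists j undefined-small
  ... | x , px@((_ , (v , ev) , _) , _) = B-diagonal px ev (correct x v ev)

lemma5p5 : ExcludedMiddle 0ℓ →
    ( ((A : ℕ → Bool) → IntrinsicallyGenericallyComputable A → IntrinsicallyCoarselyComputable A) →
      (A : ℕ → Bool) → IntrinsicallyDenselyComputable A ⇔ IntrinsicallyCoarselyComputable A )
    ×
    ( (∃ λ (A : ℕ → Bool) → IntrinsicallyGenericallyComputable A × ¬ IntrinsicallyCoarselyComputable A) →
      ((A : ℕ → Bool) → IntrinsicallyGenericallyComputable A → IntrinsicallyDenselyComputable A)
      × (∃ λ (A : ℕ → Bool) → IntrinsicallyDenselyComputable A × ¬ IntrinsicallyGenericallyComputable A)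
      × ((A : ℕ → Bool) → IntrinsicallyCoarselyComputable A → IntrinsicallyDenselyComputable A)
      × (∃ λ (A : ℕ → Bool) → IntrinsicallyDenselyComputable A × ¬ IntrinsicallyCoarselyComputable A) )
lemma5p5 lem =
  (λ generic⊆′coarse A → mk⇔ (dense⊆′coarse generic⊆′coarse A) (coarse⊆′dense A)) ,
  λ { (A , A-generic , A-not-coarse) →
        generic⊆′dense ,
        (B , coarse⊆′dense B B-coarse , B-not-generic) ,
        coarse⊆′dense ,
        (A , generic⊆′dense A A-generic , A-not-coarse) }
  where open Classical lem
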